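{- Let $q$ be a prime power, $h\ge 3$, and let $\lambda$ be a primitive element of $\mathbb{F}_{q^h}$. The set $$\mathcal{C}=\{\langle(t_1\lambda+t_2\lambda^2+\dots+t_{h-1}\lambda^{h-1},\ t_{h-1}+t_h\lambda)\rangle_{\mathbb{F}_{q^h}} : t_i\in\mathbb{F}_q,\ (t_1,\dots,t_h)\neq(0,\dots,0)\}\subseteq\mathrm{PG}(1,q^h)$$ is an $\mathbb{F}_q$-linear $(h-2)$-club of rank $h$ with head $(1,0)$. Consequently $|\mathcal{C}|=q^{h-1}+q^{h-2}+1$.
   Context: An $\mathbb{F}_q$-linear set of rank $k$ in $\mathrm{PG}(1,q^h)$ is the set of points $\{\langle w\rangle_{\mathbb{F}_{q^h}}: w\in W\setminus\{0\}\}$ for some $k$-dimensional $\mathbb{F}_q$-subspace $W$ of $\mathbb{F}_{q^h}^2$. The weight of a point $\langle v\rangle_{\mathbb{F}_{q^h}}$ in it is $\dim_{\mathbb{F}_q}(W\cap\langle v\rangle_{\mathbb{F}_{q^h}})$. An $i$-club of rank $k$ is an $\mathbb{F}_q$-linear set of rank $k$ in which one point (the head) has weight $i$ and all other points have weight $1$. -}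

module Defs where

open import Level using (0ℓ)
open import Data.Nat as ℕ using (ℕ; zero; suc; _∸_; _<ᵇ_; _≡ᵇ_)
open import Data.Fin using (Fin; toℕ)
open import Data.Vec using (Vec; []; _∷_; replicate)
open import Data.Product using (Σ; ∃; _×_; _,_)
open import Data.Bool using (if_then_else_)
open import Relation.Binary.PropositionalEquality using (_≡_; _≢_)
open import Relation.Nullary using (¬_)
open import Algebra.Structures using (IsCommutativeRing)
open import Data.List using (List)
open import Data.List.Relation.Unary.AllPairs using (AllPairs)
open import Data.List.Relation.Unary.Any using (Any)
open import Data.List.Relation.Unary.All using (All)

record Field : Set₁ where
  infixl 7 _*_
  infixl 6 _+_
  field
    Carrier : Set
    _+_ _*_ : Carrier → Carrier → Carrier
    -_      : Carrier → Carrier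
    0# 1#   : Carrier
    isCommutativeRing : IsCommutativeRing _≡_ _+_ _*_ -_ 0# 1#
    0≢1     : 0# ≢ 1#
    inverse : ∀ x → x ≢ 0# → ∃ λ y → x * y ≡ 1#

  pow : Carrier → ℕ → Carrier
  pow x zero    = 1#
  pow x (suc n) = x * pow x n

  sumV : ∀ {n} → Vec Carrier n → Carrier
  sumV []       = 0#
  sumV (x ∷ xs) = x + sumV xs

  Primitive : Carrier → Set
  Primitive g = ∀ x → x ≢ 0# → ∃ λ n → pow g n ≡ x

-- An injective ring homomorphism F → K (F viewed as a subfield of K)
record Embedding (F K : Field) : Set where
  private
    module F = Field F
    module K = Field K
  field
    ι      : F.Carrier → K.Carrier
    ι-+    : ∀ a b → ι (a F.+ b) ≡ ι a K.+ ι b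
    ι-*    : ∀ a b → ι (a F.* b) ≡ ι a K.* ι b
    ι-1    : ι F.1# ≡ K.1#
    ι-inj  : ∀ a b → ι a ≡ ι b → a ≡ b

module LinearSets (F K : Field) (E : Embedding F K) where
  private
    module F = Field F
    module K = Field K
  open Embedding E

  V : Set
  V = K.Carrier × K.Carrier

  zeroV : V
  zeroV = (K.0# , K.0#)

  _⊕_ : V → V → V
  (a , b) ⊕ (c , d) = (a K.+ c , b K.+ d)

  _·_ : K.Carrier → V → V
  c · (a , b) = (c K.* a , c K.* b)

  comb : ∀ {d} → Vec F.Carrier d → Vec V d → V
  comb []       []       = zeroV
  comb (t ∷ ts) (b ∷ bs) = (ι t · b) ⊕ comb ts bs

  HasDim : (V → Set) → ℕ → Set
  HasDim S d =
    Σ (Vec V d) λ b →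
      (∀ t t′ → comb t b ≡ comb t′ b → t ≡ t′) ×
      (∀ w → (S w → ∃ λ t → comb t b ≡ w) × (∃ (λ t → comb t b ≡ w) → S w))

  InSpan : V → V → Set
  InSpan v w = ∃ λ c → w ≡ c · v

  -- v and w represent the same point of PG(1,K) (v, w nonzero)
  SamePoint : V → V → Set
  SamePoint v w = InSpan v w

  InLinSet : (V → Set) → V → Set
  InLinSet W v = v ≢ zeroV × ∃ λ w → W w × w ≢ zeroV × InSpan v w

  Weight : (V → Set) → V → ℕ → Set
  Weight W v d = HasDim (λ w → W w × InSpan v w) d

  -- a point set P (given by a predicate on nonzero representatives, closed
  -- under proportionality) has exactly N points: a list of N pairwise
  -- distinct points of P containing (a representative of) every point of P
  NumPoints : (V → Set) → ℕ → Set
  NumPoints P N =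
    Σ (List V) λ ps →
      Data.List.length ps ≡ N ×
      All P ps ×
      AllPairs (λ u v → ¬ SamePoint u v) ps ×
      (∀ v → P v → Any (SamePoint v) ps)

module ClubExample (F K : Field) (E : Embedding F K) (h : ℕ) (lam : Field.Carrier K) where
  private
    module F = Field F
    module K = Field K
  open Embedding E
  open LinearSets F K E

  -- t = (t₁,…,t_h) is stored 0-based: the entry at j : Fin h is t_{j+1}.
  -- first coordinate  t₁λ + t₂λ² + … + t_{h-1}λ^{h-1}
  coord₁ : Vec F.Carrier h → K.Carrier
  coord₁ t = K.sumV (Data.Vec.map (λ jt → term (Data.Product.proj₁ jt) (Data.Product.proj₂ jt))
                                    (Data.Vec.zip (Data.Vec.allFin h) t))
    where
    term : Fin h → F.Carrier → K.Carrier
    term j s = if suc (toℕ j) <ᵇ h then ι s K.* K.pow lam (suc (toℕ j)) else K.0#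

  -- second coordinate  t_{h-1} + t_h λ
  coord₂ : Vec F.Carrier h → K.Carrier
  coord₂ t = K.sumV (Data.Vec.map (λ jt → term (Data.Product.proj₁ jt) (Data.Product.proj₂ jt))
                                    (Data.Vec.zip (Data.Vec.allFin h) t))
    where
    term : Fin h → F.Carrier → K.Carrier
    term j s = if suc (suc (toℕ j)) ≡ᵇ h then ι s
               else if suc (toℕ j) ≡ᵇ h then ι s K.* lam
               else K.0#

  vec : Vec F.Carrier h → V
  vec t = (coord₁ t , coord₂ t)

  W : V → Set
  W w = ∃ λ t → vec t ≡ w

  InC : V → Set
  InC v = v ≢ zeroV × ∃ λ t → t ≢ replicate h F.0# × vec t ≢ zeroV × InSpan v (vec t)

-- Write t = (x₁ , … , x_{h-2} , a , b). Then vec t = (λ·U , a + bλ) with U = x₁ + x₂λ + … + aλ^{h-2}, and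
-- 1, λ, …, λ^{h-1} are F-independent because λ generates K and |K| = q^h. Hence t ↦ vec t is injective (rank h),
-- vec t lies on ⟨(1,0)⟩ iff a = b = 0 (weight h-2), and if vec s = μ·vec t with a + bλ ≠ 0 then the
-- λ^{h-1}-coefficients of (a + bλ)·U_s = (a_s + b_s λ)·U give b·a_s = b_s·a, so (a_s , b_s) ∈ F·(a , b) and μ ∈ F
-- (weight 1). Normalising (a , b) to (a , 1) or (1 , 0) gives q^{h-1} + q^{h-2} points besides the head.
module Submission where

open import Defs
open import Level using (0ℓ)
open import Algebra.Bundles using (CommutativeRing)
import Algebra.Properties.Group as GroupProperties
import Algebra.Properties.Ring as RingProperties
import Algebra.Solver.Ring.NaturalCoefficients.Default as NaturalCoefficients
open import Data.Bool using (true; false; if_then_else_; T)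
open import Data.Empty using (⊥; ⊥-elim)
open import Data.Unit using (tt)
open import Data.Fin as Fin using (Fin; toℕ)
import Data.Fin.Properties as FinP
open import Data.List as List using (List; []; _∷_; _++_; length)
import Data.List.Properties as ListP
open import Data.List.Membership.Propositional using (_∈_)
import Data.List.Membership.Propositional.Properties as ∈P
import Data.List.Relation.Unary.AllPairs.Properties as AllPairsP
open import Data.List.Relation.Unary.All as All using (All; []; _∷_)
import Data.List.Relation.Unary.All.Properties as AllP
open import Data.List.Relation.Unary.AllPairs as AllPairs using (AllPairs; []; _∷_)
open import Data.List.Relation.Unary.Any as Any using (Any; here)
import Data.List.Relation.Unary.Any.Properties as AnyP
open import Data.List.Relation.Unary.Unique.Propositional using (Unique)
import Data.List.Relation.Unary.Unique.Propositional.Properties as UniqueP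
open import Data.Nat as ℕ using (ℕ; zero; suc; _^_; _∸_; _≤_; _<_; _<ᵇ_; _≡ᵇ_; z≤n; s≤s)
import Data.Nat.Properties as ℕP
open import Data.Nat.Primality using (Prime)
open import Data.Product using (∃; ∃₂; _×_; _,_; proj₁; proj₂)
open import Data.Sum using (_⊎_; inj₁; inj₂)
open import Data.Vec as Vec using (Vec; []; _∷_; _∷ʳ_; replicate; zipWith; initLast)
import Data.Vec.Properties as VecP
open import Function using (_∘_)
open import Function.Bundles using (_↔_; Inverse; Injection)
open import Function.Definitions using (Injective)
open import Function.Properties.Inverse using (↔-sym; ↔⇒↣)
open import Relation.Binary.Definitions using (DecidableEquality)
open import Relation.Binary.PropositionalEquality
open import Relation.Nullary using (¬_; yes; no; contradiction)
open import Relation.Nullary.Decidable using (via-injection)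

module FieldProperties (K : Field) where
  open Field K

  commutativeRing : CommutativeRing 0ℓ 0ℓ
  commutativeRing = record { isCommutativeRing = isCommutativeRing }

  open CommutativeRing commutativeRing public
    using ( +-identityˡ; +-identityʳ; *-identityˡ; *-identityʳ; zeroˡ; zeroʳ
          ; *-comm; *-assoc; -‿inverseʳ; distribˡ; distribʳ; +-group; ring)
  open GroupProperties +-group public using (∙-cancelʳ; inverseʳ-unique; x∙y⁻¹≈ε⇒x≈y)
  open RingProperties ring public using (-‿distribˡ-*; -‿distribʳ-*; -1*x≈-x)
  open NaturalCoefficients (CommutativeRing.commutativeSemiring commutativeRing) public
    using (solve; _:+_; _:*_; _:=_; con)

  x+x≡x⇒x≡0 : ∀ {x} → x + x ≡ x → x ≡ 0#
  x+x≡x⇒x≡0 {x} e = ∙-cancelʳ x x 0# (trans e (sym (+-identityˡ x)))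

  x*y≡z*w⇒y≡x⁻¹*z*w : ∀ {x x⁻¹ y z w} → x * x⁻¹ ≡ 1# → x * y ≡ z * w → y ≡ x⁻¹ * z * w
  x*y≡z*w⇒y≡x⁻¹*z*w {x} {x⁻¹} {y} {z} {w} xx⁻¹≡1 e = begin
    y                ≡⟨ sym (*-identityˡ y) ⟩
    1# * y           ≡⟨ cong (_* y) (sym (trans (*-comm x⁻¹ x) xx⁻¹≡1)) ⟩
    x⁻¹ * x * y      ≡⟨ *-assoc x⁻¹ x y ⟩
    x⁻¹ * (x * y)    ≡⟨ cong (x⁻¹ *_) e ⟩
    x⁻¹ * (z * w)    ≡⟨ sym (*-assoc x⁻¹ z w) ⟩
    x⁻¹ * z * w      ∎
    where open ≡-Reasoning

  *-cancelˡ : ∀ {x y z} → x ≢ 0# → x * y ≡ x * z → y ≡ z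
  *-cancelˡ {x} {y} {z} x≢0 e with inverse x x≢0
  ... | x⁻¹ , xx⁻¹≡1 = trans (x*y≡z*w⇒y≡x⁻¹*z*w xx⁻¹≡1 e)
    (trans (cong (_* z) (trans (*-comm x⁻¹ x) xx⁻¹≡1)) (*-identityˡ z))

  x*y≡0⇒y≡0 : ∀ {x y} → x ≢ 0# → x * y ≡ 0# → y ≡ 0#
  x*y≡0⇒y≡0 {x} x≢0 e = *-cancelˡ x≢0 (trans e (sym (zeroʳ x)))

  *-nonZero : ∀ {x y} → x ≢ 0# → y ≢ 0# → x * y ≢ 0#
  *-nonZero x≢0 y≢0 e = y≢0 (x*y≡0⇒y≡0 x≢0 e)

  Normalised : Carrier → Carrier → Set
  Normalised a b = b ≡ 1# ⊎ (b ≡ 0# × a ≡ 1#)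

  normalised≢0 : ∀ {a b} → Normalised a b → a ≢ 0# ⊎ b ≢ 0#
  normalised≢0 (inj₁ b≡1)       = inj₂ λ b≡0 → 0≢1 (trans (sym b≡0) b≡1)
  normalised≢0 (inj₂ (_ , a≡1)) = inj₁ λ a≡0 → 0≢1 (trans (sym a≡0) a≡1)

  normalised-unique : ∀ {a b r} → Normalised a b → Normalised (r * a) (r * b) → r ≡ 1#
  normalised-unique {r = r} (inj₁ refl) (inj₁ r1≡1) = trans (sym (*-identityʳ r)) r1≡1
  normalised-unique {a} {r = r} (inj₁ refl) (inj₂ (r1≡0 , ra≡1)) = contradiction (begin
    0#      ≡⟨ sym (zeroˡ a) ⟩
    0# * a  ≡⟨ cong (_* a) (trans (sym r1≡0) (*-identityʳ r)) ⟩
    r * a   ≡⟨ ra≡1 ⟩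
    1#      ∎) 0≢1
    where open ≡-Reasoning
  normalised-unique {r = r} (inj₂ (refl , _)) (inj₁ r0≡1) = contradiction (trans (sym (zeroʳ r)) r0≡1) 0≢1
  normalised-unique {r = r} (inj₂ (_ , refl)) (inj₂ (_ , r1≡1)) = trans (sym (*-identityʳ r)) r1≡1

  module _ (_≟_ : DecidableEquality Carrier) where

    normalise : ∀ {a b} → ¬ (a ≡ 0# × b ≡ 0#) → ∃ λ r → Normalised (r * a) (r * b)
    normalise {a} {b} ab≢0 with b ≟ 0#
    ... | no b≢0 with inverse b b≢0
    ...   | b⁻¹ , bb⁻¹≡1 = b⁻¹ , inj₁ (trans (*-comm b⁻¹ b) bb⁻¹≡1)
    normalise {a} {b} ab≢0 | yes b≡0 with inverse a (λ a≡0 → ab≢0 (a≡0 , b≡0))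
    ...   | a⁻¹ , aa⁻¹≡1 = a⁻¹ , inj₂ (trans (cong (a⁻¹ *_) b≡0) (zeroʳ a⁻¹) , trans (*-comm a⁻¹ a) aa⁻¹≡1)

    cross≡⇒proportional : ∀ {a b a′ b′} → b * a′ ≡ b′ * a → ¬ (a ≡ 0# × b ≡ 0#) →
                          ∃ λ r → a′ ≡ r * a × b′ ≡ r * b
    cross≡⇒proportional {a} {b} {a′} {b′} cross ab≢0 with b ≟ 0#
    ... | no b≢0 with inverse b b≢0
    ...   | b⁻¹ , bb⁻¹≡1 = b⁻¹ * b′ , x*y≡z*w⇒y≡x⁻¹*z*w bb⁻¹≡1 cross , x*y≡z*w⇒y≡x⁻¹*z*w bb⁻¹≡1 (*-comm b b′)
    cross≡⇒proportional {a} {b} {a′} {b′} cross ab≢0 | yes b≡0 with a ≟ 0#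
    ... | yes a≡0 = contradiction (a≡0 , b≡0) ab≢0
    ... | no a≢0 with inverse a a≢0
    ...   | a⁻¹ , aa⁻¹≡1 = a⁻¹ * a′ , x*y≡z*w⇒y≡x⁻¹*z*w aa⁻¹≡1 (*-comm a a′) , b′≡
      where
      open ≡-Reasoning
      b′≡ : b′ ≡ a⁻¹ * a′ * b
      b′≡ = begin
        b′              ≡⟨ x*y≡0⇒y≡0 a≢0 (trans (*-comm a b′) (trans (sym cross) (trans (cong (_* a′) b≡0) (zeroˡ a′)))) ⟩
        0#              ≡⟨ sym (zeroʳ _) ⟩
        a⁻¹ * a′ * 0#   ≡⟨ cong (a⁻¹ * a′ *_) (sym b≡0) ⟩
        a⁻¹ * a′ * b    ∎

-- Imported only after FieldProperties, whose body uses the field's _+_.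
open import Data.Nat using (_+_)

module EmbeddingProperties {F K : Field} (E : Embedding F K) where
  private
    module F = Field F
    module K = Field K
    module FP = FieldProperties F
    module KP = FieldProperties K
  open Embedding E

  ι-0 : ι F.0# ≡ K.0#
  ι-0 = KP.x+x≡x⇒x≡0 (trans (sym (ι-+ F.0# F.0#)) (cong ι (FP.+-identityʳ F.0#)))

  ι-‿ : ∀ a → ι (F.- a) ≡ K.- ι a
  ι-‿ a = KP.inverseʳ-unique (ι a) (ι (F.- a))
    (trans (sym (ι-+ a (F.- a))) (trans (cong ι (FP.-‿inverseʳ a)) ι-0))

module _ {A : Set} where

  zipWith-∷ʳ : ∀ (f : A → A → A) {k} (xs ys : Vec A k) x y →
               zipWith f (xs ∷ʳ x) (ys ∷ʳ y) ≡ zipWith f xs ys ∷ʳ f x y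
  zipWith-∷ʳ f []       []       x y = refl
  zipWith-∷ʳ f (a ∷ xs) (b ∷ ys) x y = cong (f a b ∷_) (zipWith-∷ʳ f xs ys x y)

  enumeration⇒≤ : ∀ {n} (xs : List A) → (∀ x → x ∈ xs) →
                  (f : Fin n → A) → Injective _≡_ _≡_ f → n ≤ length xs
  enumeration⇒≤ xs complete f f-inj = FinP.injective⇒≤ (f-inj ∘ index-injective)
    where
    index : A → Fin (length xs)
    index x = Any.index (complete x)
    index-injective : ∀ {x y} → index x ≡ index y → x ≡ y
    index-injective {x} {y} e = trans (AnyP.lookup-index (complete x))
      (trans (cong (List.lookup xs) e) (sym (AnyP.lookup-index (complete y))))

  vectors : List A → ∀ k → List (Vec A k)
  vectors xs zero    = [] ∷ []
  vectors xs (suc k) = List.cartesianProductWith _∷_ xs (vectors xs k)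

  length-vectors : ∀ xs k → length (vectors xs k) ≡ length xs ^ k
  length-vectors xs zero    = refl
  length-vectors xs (suc k) = trans (length-product xs) (cong (length xs ℕ.*_) (length-vectors xs k))
    where
    length-product : ∀ ys → length (List.cartesianProductWith _∷_ ys (vectors xs k))
                            ≡ length ys ℕ.* length (vectors xs k)
    length-product []       = refl
    length-product (y ∷ ys) = trans (ListP.length-++ (List.map (y ∷_) (vectors xs k)))
      (cong₂ _+_ (ListP.length-map (y ∷_) (vectors xs k)) (length-product ys))

  ∈-vectors : ∀ {xs} → (∀ x → x ∈ xs) → ∀ {k} (v : Vec A k) → v ∈ vectors xs k
  ∈-vectors complete []      = here refl
  ∈-vectors complete (x ∷ v) = ∈P.∈-cartesianProductWith⁺ _∷_ (complete x) (∈-vectors complete v)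

  vectors-unique : ∀ {xs} → Unique xs → ∀ k → Unique (vectors xs k)
  vectors-unique xs! zero    = [] ∷ []
  vectors-unique xs! (suc k) = UniqueP.cartesianProductWith⁺ _∷_ VecP.∷-injective xs! (vectors-unique xs! k)

allPairs-map : ∀ {A B : Set} {P : A → Set} {R : B → B → Set} (f : A → B) →
               (∀ {x y} → P x → P y → x ≢ y → R (f x) (f y)) →
               ∀ {xs} → All P xs → Unique xs → AllPairs R (List.map f xs)
allPairs-map f R-f []         []           = []
allPairs-map f R-f (px ∷ pxs) (x∉xs ∷ xs!) =
  AllP.map⁺ (All.zipWith (λ (py , x≢y) → R-f px py x≢y) (pxs , x∉xs)) ∷ allPairs-map f R-f pxs xs!

module FiniteType {A : Set} {n : ℕ} (enum : Fin n ↔ A) where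
  open Inverse enum

  _≟_ : DecidableEquality A
  _≟_ = via-injection (↔⇒↣ (↔-sym enum)) Fin._≟_

  elements : List A
  elements = List.tabulate to

  ∈-elements : ∀ x → x ∈ elements
  ∈-elements x = subst (_∈ elements) (strictlyInverseˡ x) (∈P.∈-tabulate⁺ (from x))

  length-elements : length elements ≡ n
  length-elements = ListP.length-tabulate to

  elements-unique : Unique elements
  elements-unique = UniqueP.tabulate⁺ (Injection.injective (↔⇒↣ enum))

  length-vectors-elements : ∀ k → length (vectors elements k) ≡ n ^ k
  length-vectors-elements k = trans (length-vectors elements k) (cong (_^ k) length-elements)

1<∣F∣ : ∀ (F : Field) {q} → Fin q ↔ Field.Carrier F → 1 < q
1<∣F∣ F enum = FinP.injective⇒≤ {f = f} f-injective
  where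
  open Field F
  open Inverse enum
  f : Fin 2 → Fin _
  f Fin.zero           = from 0#
  f (Fin.suc Fin.zero) = from 1#
  from-injective : ∀ {x y} → from x ≡ from y → x ≡ y
  from-injective = Injection.injective (↔⇒↣ (↔-sym enum))
  f-injective : Injective _≡_ _≡_ f
  f-injective {Fin.zero}           {Fin.zero}           _ = refl
  f-injective {Fin.zero}           {Fin.suc Fin.zero}   e = ⊥-elim (0≢1 (from-injective e))
  f-injective {Fin.suc Fin.zero}   {Fin.zero}           e = ⊥-elim (0≢1 (sym (from-injective e)))
  f-injective {Fin.suc Fin.zero}   {Fin.suc Fin.zero}   _ = refl

module Vectors (F : Field) where
  private
    module F = Field F
    module FP = FieldProperties F

  infixl 6 _⊞_
  infixr 7 _⊛_

  _⊞_ : ∀ {k} → Vec F.Carrier k → Vec F.Carrier k → Vec F.Carrier k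
  _⊞_ = zipWith F._+_

  _⊛_ : ∀ {k} → F.Carrier → Vec F.Carrier k → Vec F.Carrier k
  r ⊛ t = Vec.map (r F.*_) t

  0ᵥ : ∀ k → Vec F.Carrier k
  0ᵥ k = replicate k F.0#

  0ᵥ-∷ʳ : ∀ k → 0ᵥ (suc k) ≡ 0ᵥ k ∷ʳ F.0#
  0ᵥ-∷ʳ zero    = refl
  0ᵥ-∷ʳ (suc k) = cong (F.0# ∷_) (0ᵥ-∷ʳ k)

  ⊛-identityˡ : ∀ {k} (t : Vec F.Carrier k) → F.1# ⊛ t ≡ t
  ⊛-identityˡ []      = refl
  ⊛-identityˡ (x ∷ t) = cong₂ _∷_ (FP.*-identityˡ x) (⊛-identityˡ t)

  ∷ʳ-⊞ : ∀ {k} (xs ys : Vec F.Carrier k) a b → (xs ∷ʳ a) ⊞ (ys ∷ʳ b) ≡ (xs ⊞ ys) ∷ʳ (a F.+ b)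
  ∷ʳ-⊞ = zipWith-∷ʳ F._+_

  ∷ʳ-⊛ : ∀ {k} r (xs : Vec F.Carrier k) a → r ⊛ (xs ∷ʳ a) ≡ (r ⊛ xs) ∷ʳ (r F.* a)
  ∷ʳ-⊛ r xs a = VecP.map-∷ʳ (r F.*_) a xs

  ⊛-0ᵥ-⊞ : ∀ {k} r (t : Vec F.Carrier k) → r ⊛ 0ᵥ k ⊞ t ≡ t
  ⊛-0ᵥ-⊞ r []      = refl
  ⊛-0ᵥ-⊞ r (x ∷ t) = cong₂ _∷_ (trans (cong (F._+ x) (FP.zeroʳ r)) (FP.+-identityˡ x)) (⊛-0ᵥ-⊞ r t)

  ⊞-‿⊛≡0ᵥ⇒≡ : ∀ {k} (xs ys : Vec F.Carrier k) → xs ⊞ (F.- F.1#) ⊛ ys ≡ 0ᵥ k → xs ≡ ys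
  ⊞-‿⊛≡0ᵥ⇒≡ []       []       _ = refl
  ⊞-‿⊛≡0ᵥ⇒≡ (x ∷ xs) (y ∷ ys) e = cong₂ _∷_
    (FP.x∙y⁻¹≈ε⇒x≈y x y (trans (cong (x F.+_) (sym (FP.-1*x≈-x y))) (VecP.∷-injectiveˡ e)))
    (⊞-‿⊛≡0ᵥ⇒≡ xs ys (VecP.∷-injectiveʳ e))

module Evaluation {F K : Field} (E : Embedding F K) (lam : Field.Carrier K) where
  private
    module F = Field F
    module K = Field K
    module KP = FieldProperties K
  open KP using (solve; _:+_; _:*_; _:=_; con)
  open Embedding E
  open EmbeddingProperties E
  open Vectors F

  eval : ∀ {k} → Vec F.Carrier k → K.Carrier
  eval []       = K.0#
  eval (c ∷ cs) = ι c K.+ lam K.* eval cs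

  eval-∷ʳ : ∀ {k} (cs : Vec F.Carrier k) c → eval (cs ∷ʳ c) ≡ eval cs K.+ ι c K.* K.pow lam k
  eval-∷ʳ []       c = solve 2 (λ c l → c :+ l :* con 0 := con 0 :+ c :* con 1) refl (ι c) lam
  eval-∷ʳ {suc k} (x ∷ cs) c = begin
    ι x K.+ lam K.* eval (cs ∷ʳ c)                        ≡⟨ cong (λ y → ι x K.+ lam K.* y) (eval-∷ʳ cs c) ⟩
    ι x K.+ lam K.* (eval cs K.+ ι c K.* K.pow lam k)     ≡⟨ solve 5 (λ x l e c p → x :+ l :* (e :+ c :* p) := (x :+ l :* e) :+ c :* (l :* p))
                                                                refl (ι x) lam (eval cs) (ι c) (K.pow lam k) ⟩
    ι x K.+ lam K.* eval cs K.+ ι c K.* K.pow lam (suc k) ∎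
    where open ≡-Reasoning

  eval-⊞ : ∀ {k} (cs ds : Vec F.Carrier k) → eval (cs ⊞ ds) ≡ eval cs K.+ eval ds
  eval-⊞ []       []       = sym (KP.+-identityˡ K.0#)
  eval-⊞ (c ∷ cs) (d ∷ ds) = trans (cong₂ (λ x y → x K.+ lam K.* y) (ι-+ c d) (eval-⊞ cs ds))
    (solve 5 (λ c d l x y → (c :+ d) :+ l :* (x :+ y) := (c :+ l :* x) :+ (d :+ l :* y))
           refl (ι c) (ι d) lam (eval cs) (eval ds))

  eval-⊛ : ∀ {k} r (cs : Vec F.Carrier k) → eval (r ⊛ cs) ≡ ι r K.* eval cs
  eval-⊛ r []       = sym (KP.zeroʳ (ι r))
  eval-⊛ r (c ∷ cs) = trans (cong₂ (λ x y → x K.+ lam K.* y) (ι-* r c) (eval-⊛ r cs))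
    (solve 4 (λ r c l x → r :* c :+ l :* (r :* x) := r :* (c :+ l :* x)) refl (ι r) (ι c) lam (eval cs))

  eval-0ᵥ : ∀ k → eval (0ᵥ k) ≡ K.0#
  eval-0ᵥ zero    = refl
  eval-0ᵥ (suc k) = trans (cong₂ (λ x y → x K.+ lam K.* y) ι-0 (eval-0ᵥ k))
    (solve 1 (λ l → con 0 :+ l :* con 0 := con 0) refl lam)

  mulLinear : ∀ {k} → F.Carrier → F.Carrier → Vec F.Carrier k → Vec F.Carrier (suc k)
  mulLinear a b cs = a ⊛ (cs ∷ʳ F.0#) ⊞ b ⊛ (F.0# ∷ cs)

  eval-mulLinear : ∀ {k} a b (cs : Vec F.Carrier k) → eval (mulLinear a b cs) ≡ eval (a ∷ b ∷ []) K.* eval cs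
  eval-mulLinear {k} a b cs = begin
    eval (a ⊛ (cs ∷ʳ F.0#) ⊞ b ⊛ (F.0# ∷ cs))
      ≡⟨ eval-⊞ (a ⊛ (cs ∷ʳ F.0#)) (b ⊛ (F.0# ∷ cs)) ⟩
    eval (a ⊛ (cs ∷ʳ F.0#)) K.+ eval (b ⊛ (F.0# ∷ cs))
      ≡⟨ cong₂ K._+_ (eval-⊛ a (cs ∷ʳ F.0#)) (eval-⊛ b (F.0# ∷ cs)) ⟩
    ι a K.* eval (cs ∷ʳ F.0#) K.+ ι b K.* (ι F.0# K.+ lam K.* X)
      ≡⟨ cong (λ y → ι a K.* y K.+ ι b K.* (ι F.0# K.+ lam K.* X)) (eval-∷ʳ cs F.0#) ⟩
    ι a K.* (X K.+ ι F.0# K.* P) K.+ ι b K.* (ι F.0# K.+ lam K.* X)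
      ≡⟨ cong (λ z → ι a K.* (X K.+ z K.* P) K.+ ι b K.* (z K.+ lam K.* X)) ι-0 ⟩
    ι a K.* (X K.+ K.0# K.* P) K.+ ι b K.* (K.0# K.+ lam K.* X)
      ≡⟨ solve 5 (λ a b l x p → a :* (x :+ con 0 :* p) :+ b :* (con 0 :+ l :* x) := (a :+ l :* (b :+ l :* con 0)) :* x)
               refl (ι a) (ι b) lam X P ⟩
    eval (a ∷ b ∷ []) K.* X
      ∎
    where
    open ≡-Reasoning
    X = eval cs
    P = K.pow lam k

  mulLinear-∷ʳ : ∀ {k} a b (cs : Vec F.Carrier k) c →
                 mulLinear a b (cs ∷ʳ c) ≡ (a ⊛ (cs ∷ʳ c) ⊞ b ⊛ (F.0# ∷ cs)) ∷ʳ (a F.* F.0# F.+ b F.* c)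
  mulLinear-∷ʳ a b cs c = trans (cong₂ _⊞_ (∷ʳ-⊛ a (cs ∷ʳ c) F.0#) (∷ʳ-⊛ b (F.0# ∷ cs) c))
    (∷ʳ-⊞ (a ⊛ (cs ∷ʳ c)) (b ⊛ (F.0# ∷ cs)) (a F.* F.0#) (b F.* c))

  Expressible : ℕ → K.Carrier → Set
  Expressible k x = ∃ λ (cs : Vec F.Carrier k) → eval cs ≡ x

  eval-∷ʳ≡0⇒expressible : ∀ {k} (cs : Vec F.Carrier k) {c} → c ≢ F.0# →
                          eval (cs ∷ʳ c) ≡ K.0# → Expressible k (K.pow lam k)
  eval-∷ʳ≡0⇒expressible {k} cs {c} c≢0 e with F.inverse c c≢0
  ... | c⁻¹ , cc⁻¹≡1 = (F.- c⁻¹) ⊛ cs , (begin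
    eval ((F.- c⁻¹) ⊛ cs)            ≡⟨ eval-⊛ (F.- c⁻¹) cs ⟩
    ι (F.- c⁻¹) K.* eval cs          ≡⟨ cong (K._* eval cs) (ι-‿ c⁻¹) ⟩
    K.- ι c⁻¹ K.* eval cs            ≡⟨ sym (KP.-‿distribˡ-* (ι c⁻¹) (eval cs)) ⟩
    K.- (ι c⁻¹ K.* eval cs)          ≡⟨ KP.-‿distribʳ-* (ι c⁻¹) (eval cs) ⟩
    ι c⁻¹ K.* K.- eval cs            ≡⟨ cong (ι c⁻¹ K.*_) (sym cP≡-cs) ⟩
    ι c⁻¹ K.* (ι c K.* P)            ≡⟨ solve 3 (λ i c p → i :* (c :* p) := (c :* i) :* p) refl (ι c⁻¹) (ι c) P ⟩
    ι c K.* ι c⁻¹ K.* P              ≡⟨ cong (K._* P) (trans (sym (ι-* c c⁻¹)) (trans (cong ι cc⁻¹≡1) ι-1)) ⟩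
    K.1# K.* P                       ≡⟨ KP.*-identityˡ P ⟩
    P                                ∎)
    where
    open ≡-Reasoning
    P = K.pow lam k
    cP≡-cs : ι c K.* P ≡ K.- eval cs
    cP≡-cs = KP.inverseʳ-unique (eval cs) (ι c K.* P) (trans (sym (eval-∷ʳ cs c)) e)

  expressible-1 : ∀ {k} → Expressible k (K.pow lam k) → Expressible k K.1#
  expressible-1 {zero}  ([] , 0≡1) = ⊥-elim (K.0≢1 0≡1)
  expressible-1 {suc k} _ = F.1# ∷ 0ᵥ k , trans (cong₂ (λ x y → x K.+ lam K.* y) ι-1 (eval-0ᵥ k))
    (solve 1 (λ l → con 1 :+ l :* con 0 := con 1) refl lam)

  module _ {k} (lamᵏ : Expressible k (K.pow lam k)) where

    -- λ · (c₀ + … + c_{k-1} λ^{k-1}) shifts the coefficients up; the overflowing λᵏ term is re-expressed.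
    expressible-*λ : ∀ (cs : Vec F.Carrier k) → Expressible k (lam K.* eval cs)
    expressible-*λ cs with initLast (F.0# ∷ cs)
    ... | ys , y , shifted = ys ⊞ y ⊛ rs , (begin
      eval (ys ⊞ y ⊛ rs)               ≡⟨ eval-⊞ ys (y ⊛ rs) ⟩
      eval ys K.+ eval (y ⊛ rs)        ≡⟨ cong (eval ys K.+_) (trans (eval-⊛ y rs) (cong (ι y K.*_) eval-rs)) ⟩
      eval ys K.+ ι y K.* K.pow lam k  ≡⟨ sym (eval-∷ʳ ys y) ⟩
      eval (ys ∷ʳ y)                   ≡⟨ cong eval (sym shifted) ⟩
      ι F.0# K.+ lam K.* eval cs       ≡⟨ cong (K._+ lam K.* eval cs) ι-0 ⟩
      K.0# K.+ lam K.* eval cs         ≡⟨ KP.+-identityˡ _ ⟩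
      lam K.* eval cs                  ∎)
      where
      open ≡-Reasoning
      rs = proj₁ lamᵏ
      eval-rs = proj₂ lamᵏ

    expressible-pow : ∀ j → Expressible k (K.pow lam j)
    expressible-pow zero = expressible-1 lamᵏ
    expressible-pow (suc j) with expressible-pow j
    ... | cs , eval-cs = proj₁ (expressible-*λ cs) , trans (proj₂ (expressible-*λ cs)) (cong (lam K.*_) eval-cs)

    expressible-all : K.Primitive lam → DecidableEquality K.Carrier → ∀ x → Expressible k x
    expressible-all prim _≟_ x with x ≟ K.0#
    ... | yes x≡0 = 0ᵥ k , trans (eval-0ᵥ k) (sym x≡0)
    ... | no x≢0 with prim x x≢0
    ...   | j , λʲ≡x = subst (Expressible k) λʲ≡x (expressible-pow j)

-- λ generates K, so if λᵏ were an F-combination of 1, …, λ^{k-1} then every element of K would be,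
-- and K would have at most qᵏ < q^h elements.
module Independence {F K : Field} (E : Embedding F K) {q h : ℕ} {lam : Field.Carrier K}
  (prim : Field.Primitive K lam)
  (enumF : Fin q ↔ Field.Carrier F) (enumK : Fin (q ^ h) ↔ Field.Carrier K) where
  private
    module F = Field F
    module K = Field K
    module KP = FieldProperties K
    module FinF = FiniteType enumF
    module FinK = FiniteType enumK
  open Embedding E
  open EmbeddingProperties E
  open Vectors F
  open Evaluation E lam

  pow-inexpressible : ∀ {k} → k < h → ¬ Expressible k (K.pow lam k)
  pow-inexpressible {k} k<h lamᵏ = ℕP.<⇒≱ (ℕP.^-monoʳ-< q (1<∣F∣ F enumF) k<h) q^h≤q^k
    where
    coefficients : K.Carrier → Vec F.Carrier k
    coefficients x = proj₁ (expressible-all lamᵏ prim FinK._≟_ x)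
    coefficients-injective : ∀ {x y} → coefficients x ≡ coefficients y → x ≡ y
    coefficients-injective {x} {y} e =
      trans (sym (proj₂ (expressible-all lamᵏ prim FinK._≟_ x)))
        (trans (cong eval e) (proj₂ (expressible-all lamᵏ prim FinK._≟_ y)))
    q^h≤q^k : q ^ h ≤ q ^ k
    q^h≤q^k = subst (q ^ h ≤_) (FinF.length-vectors-elements k)
      (enumeration⇒≤ (vectors FinF.elements k) (∈-vectors FinF.∈-elements)
        (coefficients ∘ Inverse.to enumK)
        (Injection.injective (↔⇒↣ enumK) ∘ coefficients-injective))

  eval-kernel : ∀ {k} → k ≤ h → (cs : Vec F.Carrier k) → eval cs ≡ K.0# → cs ≡ 0ᵥ k
  eval-kernel {zero}  _   [] _ = refl
  eval-kernel {suc k} k<h cs eval-cs≡0 with initLast cs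
  ... | xs , c , refl with c FinF.≟ F.0#
  ...   | no c≢0   = contradiction (eval-∷ʳ≡0⇒expressible xs c≢0 eval-cs≡0) (pow-inexpressible k<h)
  ...   | yes refl = trans (cong (_∷ʳ F.0#) (eval-kernel (ℕP.<⇒≤ k<h) xs eval-xs≡0)) (sym (0ᵥ-∷ʳ k))
    where
    eval-xs≡0 : eval xs ≡ K.0#
    eval-xs≡0 = begin
      eval xs                                  ≡⟨ sym (KP.+-identityʳ (eval xs)) ⟩
      eval xs K.+ K.0#                         ≡⟨ cong (eval xs K.+_) (sym (KP.zeroˡ (K.pow lam k))) ⟩
      eval xs K.+ K.0# K.* K.pow lam k         ≡⟨ cong (λ z → eval xs K.+ z K.* K.pow lam k) (sym ι-0) ⟩
      eval xs K.+ ι F.0# K.* K.pow lam k       ≡⟨ sym (eval-∷ʳ xs F.0#) ⟩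
      eval (xs ∷ʳ F.0#)                        ≡⟨ eval-cs≡0 ⟩
      K.0#                                     ∎
      where open ≡-Reasoning

  eval-injective : ∀ {k} → k ≤ h → (cs ds : Vec F.Carrier k) → eval cs ≡ eval ds → cs ≡ ds
  eval-injective k≤h cs ds e = ⊞-‿⊛≡0ᵥ⇒≡ cs ds (eval-kernel k≤h _ (begin
    eval (cs ⊞ (F.- F.1#) ⊛ ds)            ≡⟨ eval-⊞ cs _ ⟩
    eval cs K.+ eval ((F.- F.1#) ⊛ ds)     ≡⟨ cong (eval cs K.+_) (eval-⊛ (F.- F.1#) ds) ⟩
    eval cs K.+ ι (F.- F.1#) K.* eval ds   ≡⟨ cong (λ z → eval cs K.+ z K.* eval ds) (trans (ι-‿ F.1#) (cong K.-_ ι-1)) ⟩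
    eval cs K.+ K.- K.1# K.* eval ds       ≡⟨ cong (eval cs K.+_) (KP.-1*x≈-x (eval ds)) ⟩
    eval cs K.+ K.- eval ds                ≡⟨ cong (λ z → eval cs K.+ K.- z) (sym e) ⟩
    eval cs K.+ K.- eval cs                ≡⟨ KP.-‿inverseʳ (eval cs) ⟩
    K.0#                                   ∎))
    where open ≡-Reasoning

module LinearImages {F K : Field} (E : Embedding F K) where
  private
    module F = Field F
    module K = Field K
    module FP = FieldProperties F
    module KP = FieldProperties K
  open Embedding E
  open EmbeddingProperties E
  open LinearSets F K E
  open Vectors F

  ·-assoc : ∀ a b (v : V) → a · (b · v) ≡ (a K.* b) · v
  ·-assoc a b (x , y) = cong₂ _,_ (sym (KP.*-assoc a b x)) (sym (KP.*-assoc a b y))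

  ·-distribʳ : ∀ a b (v : V) → (a K.+ b) · v ≡ (a · v) ⊕ (b · v)
  ·-distribʳ a b (x , y) = cong₂ _,_ (KP.distribʳ x a b) (KP.distribʳ y a b)

  1·v≡v : ∀ (v : V) → K.1# · v ≡ v
  1·v≡v (x , y) = cong₂ _,_ (KP.*-identityˡ x) (KP.*-identityˡ y)

  0·v≡0 : ∀ (v : V) → K.0# · v ≡ zeroV
  0·v≡0 (x , y) = cong₂ _,_ (KP.zeroˡ x) (KP.zeroˡ y)

  record IsLinear {j} (f : Vec F.Carrier j → V) : Set where
    field
      ⊞-homo : ∀ s t → f (s ⊞ t) ≡ f s ⊕ f t
      ⊛-homo : ∀ r t → f (r ⊛ t) ≡ ι r · f t

  open IsLinear

  linear-[] : ∀ {f : Vec F.Carrier 0 → V} → IsLinear f → f [] ≡ zeroV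
  linear-[] {f} lin = trans (⊛-homo lin F.0# []) (trans (cong (_· f []) ι-0) (0·v≡0 (f [])))

  linear-∘ : ∀ {i j} {f : Vec F.Carrier j → V} → IsLinear f → (g : Vec F.Carrier i → Vec F.Carrier j) →
             (∀ s t → g s ⊞ g t ≡ g (s ⊞ t)) → (∀ r t → r ⊛ g t ≡ g (r ⊛ t)) → IsLinear (f ∘ g)
  linear-∘ {f = f} lin g g-⊞ g-⊛ = record
    { ⊞-homo = λ s t → trans (cong f (sym (g-⊞ s t))) (⊞-homo lin (g s) (g t))
    ; ⊛-homo = λ r t → trans (cong f (sym (g-⊛ r t))) (⊛-homo lin r (g t))
    }

  linear-∘-0∷ : ∀ {j} {f : Vec F.Carrier (suc j) → V} → IsLinear f → IsLinear (f ∘ (F.0# ∷_))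
  linear-∘-0∷ lin = linear-∘ lin (F.0# ∷_)
    (λ s t → cong (_∷ _) (FP.+-identityʳ F.0#)) (λ r t → cong (_∷ _) (FP.zeroʳ r))

  line : V → Vec F.Carrier 1 → V
  line x (r ∷ []) = ι r · x

  line-linear : ∀ x → IsLinear (line x)
  line-linear x = record
    { ⊞-homo = λ { (r ∷ []) (r′ ∷ []) → trans (cong (_· x) (ι-+ r r′)) (·-distribʳ (ι r) (ι r′) x) }
    ; ⊛-homo = λ { r (r′ ∷ []) → trans (cong (_· x) (ι-* r r′)) (sym (·-assoc (ι r) (ι r′) x)) }
    }

  line-injective : ∀ x → proj₂ x ≢ K.0# → Injective _≡_ _≡_ (line x)
  line-injective x x₂≢0 {r ∷ []} {r′ ∷ []} e = cong (_∷ []) (ι-inj r r′ (KP.*-cancelˡ x₂≢0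
    (trans (KP.*-comm _ (ι r)) (trans (cong proj₂ e) (KP.*-comm (ι r′) _)))))

  Image : ∀ {j} → (Vec F.Carrier j → V) → V → Set
  Image f w = ∃ λ t → f t ≡ w

  basis : ∀ {j} → (Vec F.Carrier j → V) → Vec V j
  basis {zero}  f = []
  basis {suc j} f = f (F.1# ∷ 0ᵥ j) ∷ basis (f ∘ (F.0# ∷_))

  comb-basis : ∀ {j} {f : Vec F.Carrier j → V} → IsLinear f → ∀ t → comb t (basis f) ≡ f t
  comb-basis {zero}          lin []       = sym (linear-[] lin)
  comb-basis {suc j} {f = f} lin (t ∷ ts) = begin
    (ι t · f e₀) ⊕ comb ts (basis (f ∘ (F.0# ∷_))) ≡⟨ cong ((ι t · f e₀) ⊕_) (comb-basis (linear-∘-0∷ lin) ts) ⟩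
    (ι t · f e₀) ⊕ f (F.0# ∷ ts)                   ≡⟨ cong (_⊕ f (F.0# ∷ ts)) (sym (⊛-homo lin t e₀)) ⟩
    f (t ⊛ e₀) ⊕ f (F.0# ∷ ts)                     ≡⟨ sym (⊞-homo lin (t ⊛ e₀) (F.0# ∷ ts)) ⟩
    f (t ⊛ e₀ ⊞ (F.0# ∷ ts))                       ≡⟨ cong f (cong₂ _∷_ t*1+0≡t (⊛-0ᵥ-⊞ t ts)) ⟩
    f (t ∷ ts)                                     ∎
    where
    open ≡-Reasoning
    e₀ = F.1# ∷ 0ᵥ j
    t*1+0≡t : t F.* F.1# F.+ F.0# ≡ t
    t*1+0≡t = trans (FP.+-identityʳ _) (FP.*-identityʳ t)

  linear-image-hasDim : ∀ {j} {f : Vec F.Carrier j → V} {S : V → Set} → IsLinear f → Injective _≡_ _≡_ f →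
                        (∀ w → (S w → Image f w) × (Image f w → S w)) → HasDim S j
  linear-image-hasDim {f = f} lin f-injective S⇔image =
    basis f ,
    (λ t t′ e → f-injective (trans (sym (comb-basis lin t)) (trans e (comb-basis lin t′)))) ,
    λ w → (λ Sw → let (t , ft≡w) = proj₁ (S⇔image w) Sw in t , trans (comb-basis lin t) ft≡w) ,
          (λ { (t , e) → proj₂ (S⇔image w) (t , trans (sym (comb-basis lin t)) e) })

module _ {A : Set} where

  if-T : ∀ {b} {x y : A} → T b → (if b then x else y) ≡ x
  if-T {true} _ = refl

  if-¬T : ∀ {b} {x y : A} → ¬ T b → (if b then x else y) ≡ y
  if-¬T {false} _   = refl
  if-¬T {true}  ¬tt = contradiction tt ¬tt

module IndexedSums (K : Field) {A : Set} where
  private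
    module K = Field K

  indexedSum : (ℕ → A → K.Carrier) → ℕ → ∀ {k} → Vec A k → K.Carrier
  indexedSum g off []      = K.0#
  indexedSum g off (s ∷ t) = g off s K.+ indexedSum g (suc off) t

  sumV-zip-tabulate : ∀ g {k n} (f : Fin k → Fin n) off → (∀ i → toℕ (f i) ≡ off + toℕ i) → (t : Vec A k) →
    K.sumV (Vec.map (λ jt → g (toℕ (proj₁ jt)) (proj₂ jt)) (Vec.zip (Vec.tabulate f) t)) ≡ indexedSum g off t
  sumV-zip-tabulate g f off f≡off+ []      = refl
  sumV-zip-tabulate g f off f≡off+ (s ∷ t) = cong₂ K._+_
    (cong (λ j → g j s) (trans (f≡off+ Fin.zero) (ℕP.+-identityʳ off)))
    (sumV-zip-tabulate g (f ∘ Fin.suc) (suc off) (λ i → trans (f≡off+ (Fin.suc i)) (ℕP.+-suc off (toℕ i))) t)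

module Club {F K : Field} (E : Embedding F K) (n : ℕ) {q : ℕ} {lam : Field.Carrier K}
  (prim : Field.Primitive K lam)
  (enumF : Fin q ↔ Field.Carrier F) (enumK : Fin (q ^ suc (suc (suc n))) ↔ Field.Carrier K) where
  private
    module F = Field F
    module K = Field K
    module FP = FieldProperties F
    module KP = FieldProperties K
    module FinF = FiniteType enumF
    module FinK = FiniteType enumK
  open KP using (solve; _:+_; _:*_; _:=_; con)
  open Embedding E
  open EmbeddingProperties E
  open Vectors F
  open Evaluation E lam
  open Independence E {h = suc (suc (suc n))} prim enumF enumK
  open IndexedSums K
  open LinearSets F K E
  open LinearImages E

  m h : ℕ
  m = suc n
  h = suc (suc m)

  open ClubExample F K E h lam

  term₁ : ℕ → F.Carrier → K.Carrier
  term₁ j s = if suc j <ᵇ h then ι s K.* K.pow lam (suc j) else K.0#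

  term₂ : ℕ → F.Carrier → K.Carrier
  term₂ j s = if suc (suc j) ≡ᵇ h then ι s else if suc j ≡ᵇ h then ι s K.* lam else K.0#

  ¬T-≡ᵇ : ∀ {i j} → i ≢ j → ¬ T (i ≡ᵇ j)
  ¬T-≡ᵇ {i} {j} i≢j = i≢j ∘ ℕP.≡ᵇ⇒≡ i j

  term₁-< : ∀ {j} s → suc j < h → term₁ j s ≡ ι s K.* K.pow lam (suc j)
  term₁-< s j+1<h = if-T (ℕP.<⇒<ᵇ j+1<h)

  term₁-last : ∀ {j} s → suc j ≡ h → term₁ j s ≡ K.0#
  term₁-last s j+1≡h = if-¬T (ℕP.<-irrefl j+1≡h ∘ ℕP.<ᵇ⇒< _ h)

  term₂-< : ∀ {j} s → suc (suc j) < h → term₂ j s ≡ K.0#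
  term₂-< s j+2<h = trans (if-¬T (¬T-≡ᵇ (ℕP.<⇒≢ j+2<h))) (if-¬T (¬T-≡ᵇ (ℕP.<⇒≢ (ℕP.<-trans (ℕP.n<1+n _) j+2<h))))

  term₂-penultimate : ∀ {j} s → suc (suc j) ≡ h → term₂ j s ≡ ι s
  term₂-penultimate s j+2≡h = if-T (ℕP.≡⇒≡ᵇ _ h j+2≡h)

  term₂-last : ∀ {j} s → suc j ≡ h → term₂ j s ≡ ι s K.* lam
  term₂-last s j+1≡h = trans (if-¬T (¬T-≡ᵇ λ j+2≡h → ℕP.1+n≢n (trans j+2≡h (sym j+1≡h))))
                              (if-T (ℕP.≡⇒≡ᵇ _ h j+1≡h))

  indexedSum-term₁ : ∀ off {k} (u : Vec F.Carrier k) b → suc off + k ≡ h →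
                     indexedSum term₁ off (u ∷ʳ b) ≡ K.pow lam (suc off) K.* eval u
  indexedSum-term₁ off [] b e = begin
    term₁ off b K.+ K.0#          ≡⟨ cong (K._+ K.0#) (term₁-last b (trans (sym (ℕP.+-identityʳ (suc off))) e)) ⟩
    K.0# K.+ K.0#                 ≡⟨ solve 1 (λ p → con 0 :+ con 0 := p :* con 0) refl (K.pow lam (suc off)) ⟩
    K.pow lam (suc off) K.* K.0#  ∎
    where open ≡-Reasoning
  indexedSum-term₁ off {suc k} (x ∷ u) b e = begin
    term₁ off x K.+ indexedSum term₁ (suc off) (u ∷ʳ b)
      ≡⟨ cong₂ K._+_ (term₁-< x (subst (suc off <_) e (ℕP.m<m+n (suc off) ℕ.z<s)))
                     (indexedSum-term₁ (suc off) u b (trans (sym (ℕP.+-suc (suc off) k)) e)) ⟩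
    ι x K.* P K.+ lam K.* P K.* eval u
      ≡⟨ solve 4 (λ x p l e → x :* p :+ l :* p :* e := p :* (x :+ l :* e)) refl (ι x) P lam (eval u) ⟩
    P K.* eval (x ∷ u) ∎
    where
    open ≡-Reasoning
    P = K.pow lam (suc off)

  indexedSum-term₂ : ∀ off {k} (xs : Vec F.Carrier k) a b → suc (suc off) + k ≡ h →
                     indexedSum term₂ off ((xs ∷ʳ a) ∷ʳ b) ≡ eval (a ∷ b ∷ [])
  indexedSum-term₂ off [] a b e = begin
    term₂ off a K.+ (term₂ (suc off) b K.+ K.0#)
      ≡⟨ cong₂ (λ x y → x K.+ (y K.+ K.0#)) (term₂-penultimate a off+2≡h) (term₂-last b off+2≡h) ⟩
    ι a K.+ (ι b K.* lam K.+ K.0#)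
      ≡⟨ solve 3 (λ a b l → a :+ (b :* l :+ con 0) := a :+ l :* (b :+ l :* con 0)) refl (ι a) (ι b) lam ⟩
    eval (a ∷ b ∷ []) ∎
    where
    open ≡-Reasoning
    off+2≡h : suc (suc off) ≡ h
    off+2≡h = trans (sym (ℕP.+-identityʳ _)) e
  indexedSum-term₂ off {suc k} (x ∷ xs) a b e = begin
    term₂ off x K.+ indexedSum term₂ (suc off) ((xs ∷ʳ a) ∷ʳ b)
      ≡⟨ cong₂ K._+_ (term₂-< x (subst (suc (suc off) <_) e (ℕP.m<m+n (suc (suc off)) ℕ.z<s)))
                     (indexedSum-term₂ (suc off) xs a b (trans (sym (ℕP.+-suc (suc (suc off)) k)) e)) ⟩
    K.0# K.+ eval (a ∷ b ∷ [])
      ≡⟨ KP.+-identityˡ _ ⟩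
    eval (a ∷ b ∷ []) ∎
    where open ≡-Reasoning

  coord₁-∷ʳ : ∀ (u : Vec F.Carrier (suc m)) b → coord₁ (u ∷ʳ b) ≡ lam K.* eval u
  coord₁-∷ʳ u b = trans (sumV-zip-tabulate term₁ (λ i → i) 0 (λ _ → refl) (u ∷ʳ b))
    (trans (indexedSum-term₁ 0 u b refl) (cong (K._* eval u) (KP.*-identityʳ lam)))

  coord₂-∷ʳ∷ʳ : ∀ (xs : Vec F.Carrier m) a b → coord₂ ((xs ∷ʳ a) ∷ʳ b) ≡ eval (a ∷ b ∷ [])
  coord₂-∷ʳ∷ʳ xs a b = trans (sumV-zip-tabulate term₂ (λ i → i) 0 (λ _ → refl) ((xs ∷ʳ a) ∷ʳ b))
    (indexedSum-term₂ 0 xs a b refl)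

  data LastTwo : Vec F.Carrier h → Set where
    split : (xs : Vec F.Carrier m) (a b : F.Carrier) → LastTwo ((xs ∷ʳ a) ∷ʳ b)

  lastTwo : ∀ t → LastTwo t
  lastTwo t with initLast t
  ... | u , b , refl with initLast u
  ...   | xs , a , refl = split xs a b

  vec-split : ∀ xs a b → vec ((xs ∷ʳ a) ∷ʳ b) ≡ (lam K.* eval (xs ∷ʳ a) , eval (a ∷ b ∷ []))
  vec-split xs a b = cong₂ _,_ (coord₁-∷ʳ (xs ∷ʳ a) b) (coord₂-∷ʳ∷ʳ xs a b)

  vec-⊞ : ∀ s t → vec (s ⊞ t) ≡ vec s ⊕ vec t
  vec-⊞ s t with lastTwo s | lastTwo t
  ... | split xs a b | split ys c d = begin
    vec (((xs ∷ʳ a) ∷ʳ b) ⊞ ((ys ∷ʳ c) ∷ʳ d))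
      ≡⟨ cong vec (trans (∷ʳ-⊞ (xs ∷ʳ a) (ys ∷ʳ c) b d) (cong (_∷ʳ (b F.+ d)) (∷ʳ-⊞ xs ys a c))) ⟩
    vec (((xs ⊞ ys) ∷ʳ (a F.+ c)) ∷ʳ (b F.+ d))
      ≡⟨ vec-split (xs ⊞ ys) (a F.+ c) (b F.+ d) ⟩
    (lam K.* eval ((xs ⊞ ys) ∷ʳ (a F.+ c)) , eval ((a ∷ b ∷ []) ⊞ (c ∷ d ∷ [])))
      ≡⟨ cong₂ _,_ (cong (λ z → lam K.* eval z) (sym (∷ʳ-⊞ xs ys a c))) refl ⟩
    (lam K.* eval ((xs ∷ʳ a) ⊞ (ys ∷ʳ c)) , eval ((a ∷ b ∷ []) ⊞ (c ∷ d ∷ [])))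
      ≡⟨ cong₂ _,_ (trans (cong (lam K.*_) (eval-⊞ (xs ∷ʳ a) (ys ∷ʳ c))) (KP.distribˡ lam _ _))
                   (eval-⊞ (a ∷ b ∷ []) (c ∷ d ∷ [])) ⟩
    (lam K.* eval (xs ∷ʳ a) , eval (a ∷ b ∷ [])) ⊕ (lam K.* eval (ys ∷ʳ c) , eval (c ∷ d ∷ []))
      ≡⟨ sym (cong₂ _⊕_ (vec-split xs a b) (vec-split ys c d)) ⟩
    vec ((xs ∷ʳ a) ∷ʳ b) ⊕ vec ((ys ∷ʳ c) ∷ʳ d) ∎
    where open ≡-Reasoning

  ⊛-split : ∀ r (xs : Vec F.Carrier m) a b → r ⊛ ((xs ∷ʳ a) ∷ʳ b) ≡ ((r ⊛ xs) ∷ʳ (r F.* a)) ∷ʳ (r F.* b)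
  ⊛-split r xs a b = trans (∷ʳ-⊛ r (xs ∷ʳ a) b) (cong (_∷ʳ (r F.* b)) (∷ʳ-⊛ r xs a))

  vec-⊛ : ∀ r t → vec (r ⊛ t) ≡ ι r · vec t
  vec-⊛ r t with lastTwo t
  ... | split xs a b = begin
    vec (r ⊛ ((xs ∷ʳ a) ∷ʳ b))
      ≡⟨ cong vec (⊛-split r xs a b) ⟩
    vec (((r ⊛ xs) ∷ʳ (r F.* a)) ∷ʳ (r F.* b))
      ≡⟨ vec-split (r ⊛ xs) (r F.* a) (r F.* b) ⟩
    (lam K.* eval ((r ⊛ xs) ∷ʳ (r F.* a)) , eval (r ⊛ (a ∷ b ∷ [])))
      ≡⟨ cong₂ _,_ (cong (λ z → lam K.* eval z) (sym (∷ʳ-⊛ r xs a))) refl ⟩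
    (lam K.* eval (r ⊛ (xs ∷ʳ a)) , eval (r ⊛ (a ∷ b ∷ [])))
      ≡⟨ cong₂ _,_ (trans (cong (lam K.*_) (eval-⊛ r (xs ∷ʳ a)))
                          (solve 3 (λ l r u → l :* (r :* u) := r :* (l :* u)) refl lam (ι r) (eval (xs ∷ʳ a))))
                   (eval-⊛ r (a ∷ b ∷ [])) ⟩
    ι r · (lam K.* eval (xs ∷ʳ a) , eval (a ∷ b ∷ []))
      ≡⟨ cong (ι r ·_) (sym (vec-split xs a b)) ⟩
    ι r · vec ((xs ∷ʳ a) ∷ʳ b) ∎
    where open ≡-Reasoning

  vec-linear : IsLinear vec
  vec-linear = record { ⊞-homo = vec-⊞ ; ⊛-homo = vec-⊛ }

  eval-0∷1∷[] : eval (F.0# ∷ F.1# ∷ []) ≡ lam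
  eval-0∷1∷[] = trans (cong₂ (λ x y → x K.+ lam K.* (y K.+ lam K.* K.0#)) ι-0 ι-1)
    (solve 1 (λ l → con 0 :+ l :* (con 1 :+ l :* con 0) := l) refl lam)

  2≤h : 2 ≤ h
  2≤h = s≤s (s≤s z≤n)

  lam≢0 : lam ≢ K.0#
  lam≢0 lam≡0 = F.0≢1 (sym (VecP.∷-injectiveˡ (VecP.∷-injectiveʳ
    (eval-kernel 2≤h (F.0# ∷ F.1# ∷ []) (trans eval-0∷1∷[] lam≡0)))))

  eval-pair-injective : ∀ {a b c d} → eval (a ∷ b ∷ []) ≡ eval (c ∷ d ∷ []) → a ≡ c × b ≡ d
  eval-pair-injective {a} {b} {c} {d} e with eval-injective 2≤h (a ∷ b ∷ []) (c ∷ d ∷ []) e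
  ... | refl = refl , refl

  eval-pair≡0 : ∀ {a b} → eval (a ∷ b ∷ []) ≡ K.0# → a ≡ F.0# × b ≡ F.0#
  eval-pair≡0 e = eval-pair-injective (trans e (sym (eval-0ᵥ 2)))

  vec-injective : ∀ s t → vec s ≡ vec t → s ≡ t
  vec-injective s t e with lastTwo s | lastTwo t
  ... | split xs a b | split ys c d = cong₂ _∷ʳ_ xs∷ʳa≡ys∷ʳc (proj₂ (eval-pair-injective (cong proj₂ e′)))
    where
    e′ : (lam K.* eval (xs ∷ʳ a) , eval (a ∷ b ∷ [])) ≡ (lam K.* eval (ys ∷ʳ c) , eval (c ∷ d ∷ []))
    e′ = trans (sym (vec-split xs a b)) (trans e (vec-split ys c d))
    xs∷ʳa≡ys∷ʳc : xs ∷ʳ a ≡ ys ∷ʳ c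
    xs∷ʳa≡ys∷ʳc = eval-injective (ℕP.n≤1+n _) (xs ∷ʳ a) (ys ∷ʳ c) (KP.*-cancelˡ lam≢0 (cong proj₁ e′))

  -- Both sides are F-combinations of 1, λ, …, λ^{h-1}; compare the coefficients of λ^{h-1}.
  top-coefficients : ∀ (xs : Vec F.Carrier m) a b (ys : Vec F.Carrier m) c d →
    eval (a ∷ b ∷ []) K.* eval (ys ∷ʳ c) ≡ eval (c ∷ d ∷ []) K.* eval (xs ∷ʳ a) → b F.* c ≡ d F.* a
  top-coefficients xs a b ys c d e = begin
    b F.* c                    ≡⟨ sym (drop-a*0 a (b F.* c)) ⟩
    a F.* F.0# F.+ b F.* c     ≡⟨ VecP.∷ʳ-injectiveʳ _ _ (trans (sym (mulLinear-∷ʳ a b ys c))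
                                    (trans same-coefficients (mulLinear-∷ʳ c d xs a))) ⟩
    c F.* F.0# F.+ d F.* a     ≡⟨ drop-a*0 c (d F.* a) ⟩
    d F.* a                    ∎
    where
    open ≡-Reasoning
    drop-a*0 : ∀ x y → x F.* F.0# F.+ y ≡ y
    drop-a*0 x y = trans (cong (F._+ y) (FP.zeroʳ x)) (FP.+-identityˡ y)
    same-coefficients : mulLinear a b (ys ∷ʳ c) ≡ mulLinear c d (xs ∷ʳ a)
    same-coefficients = eval-injective ℕP.≤-refl _ _
      (trans (eval-mulLinear a b (ys ∷ʳ c)) (trans e (sym (eval-mulLinear c d (xs ∷ʳ a)))))

  -- The heart of the club property: a point of 𝒞 off the head meets W only in an F-line.
  vec-proportional⇒scalar∈F : ∀ s t μ → vec s ≡ μ · vec t → coord₂ t ≢ K.0# → ∃ λ r → μ ≡ ι r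
  vec-proportional⇒scalar∈F s t μ e A≢0 with lastTwo s | lastTwo t
  ... | split ys c d | split xs a b = r , KP.*-cancelˡ A≢0′ (begin
    A K.* μ       ≡⟨ KP.*-comm A μ ⟩
    μ K.* A       ≡⟨ sym (cong proj₂ e′) ⟩
    A′            ≡⟨ trans (cong eval (cong₂ (λ x y → x ∷ y ∷ []) c≡ra d≡rb)) (eval-⊛ r (a ∷ b ∷ [])) ⟩
    ι r K.* A     ≡⟨ KP.*-comm (ι r) A ⟩
    A K.* ι r     ∎)
    where
    open ≡-Reasoning
    U  = eval (xs ∷ʳ a)
    U′ = eval (ys ∷ʳ c)
    A  = eval (a ∷ b ∷ [])
    A′ = eval (c ∷ d ∷ [])
    A≢0′ : A ≢ K.0#
    A≢0′ = A≢0 ∘ trans (coord₂-∷ʳ∷ʳ xs a b)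
    e′ : (lam K.* U′ , A′) ≡ (μ K.* (lam K.* U) , μ K.* A)
    e′ = trans (sym (vec-split ys c d)) (trans e (cong (μ ·_) (vec-split xs a b)))
    U′≡μU : U′ ≡ μ K.* U
    U′≡μU = KP.*-cancelˡ lam≢0 (trans (cong proj₁ e′)
      (solve 3 (λ μ l u → μ :* (l :* u) := l :* (μ :* u)) refl μ lam U))
    cross : A K.* U′ ≡ A′ K.* U
    cross = begin
      A K.* U′            ≡⟨ cong (A K.*_) U′≡μU ⟩
      A K.* (μ K.* U)     ≡⟨ solve 3 (λ a μ u → a :* (μ :* u) := μ :* a :* u) refl A μ U ⟩
      μ K.* A K.* U       ≡⟨ cong (K._* U) (sym (cong proj₂ e′)) ⟩
      A′ K.* U            ∎
    ab≢0 : ¬ (a ≡ F.0# × b ≡ F.0#)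
    ab≢0 (refl , refl) = A≢0′ (eval-0ᵥ 2)
    proportional = FP.cross≡⇒proportional FinF._≟_ (top-coefficients xs a b ys c d cross) ab≢0
    r = proj₁ proportional
    c≡ra = proj₁ (proj₂ proportional)
    d≡rb = proj₂ (proj₂ proportional)

  vec-0ᵥ : vec (0ᵥ h) ≡ zeroV
  vec-0ᵥ = begin
    vec (0ᵥ h)                                      ≡⟨ cong vec (trans (0ᵥ-∷ʳ (suc m)) (cong (_∷ʳ F.0#) (0ᵥ-∷ʳ m))) ⟩
    vec ((0ᵥ m ∷ʳ F.0#) ∷ʳ F.0#)                    ≡⟨ vec-split (0ᵥ m) F.0# F.0# ⟩
    (lam K.* eval (0ᵥ m ∷ʳ F.0#) , eval (0ᵥ 2))     ≡⟨ cong₂ _,_ (cong (λ z → lam K.* eval z) (sym (0ᵥ-∷ʳ m))) (eval-0ᵥ 2) ⟩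
    (lam K.* eval (0ᵥ (suc m)) , K.0#)              ≡⟨ cong (λ z → (lam K.* z , K.0#)) (eval-0ᵥ (suc m)) ⟩
    (lam K.* K.0# , K.0#)                           ≡⟨ cong (_, K.0#) (KP.zeroʳ lam) ⟩
    zeroV                                           ∎
    where open ≡-Reasoning

  vec≢0⇒≢0ᵥ : ∀ {t} → vec t ≢ zeroV → t ≢ 0ᵥ h
  vec≢0⇒≢0ᵥ vt≢0 t≡0 = vt≢0 (trans (cong vec t≡0) vec-0ᵥ)

  dim-W : HasDim W h
  dim-W = linear-image-hasDim vec-linear (vec-injective _ _) (λ w → (λ Ww → Ww) , (λ Ww → Ww))

  InC⇔InLinSet : ∀ v → (InC v → InLinSet W v) × (InLinSet W v → InC v)
  InC⇔InLinSet v =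
    (λ { (v≢0 , t , _ , vt≢0 , v∼vt) → v≢0 , vec t , (t , refl) , vt≢0 , v∼vt }) ,
    (λ { (v≢0 , _ , (t , refl) , vt≢0 , v∼vt) → v≢0 , t , vec≢0⇒≢0ᵥ vt≢0 , vt≢0 , v∼vt })

  head : V
  head = (K.1# , K.0#)

  pad : Vec F.Carrier m → Vec F.Carrier h
  pad xs = (xs ∷ʳ F.0#) ∷ʳ F.0#

  vec-pad : ∀ xs → vec (pad xs) ≡ (lam K.* eval (xs ∷ʳ F.0#)) · head
  vec-pad xs = trans (vec-split xs F.0# F.0#)
    (cong₂ _,_ (sym (KP.*-identityʳ _)) (trans (eval-0ᵥ 2) (sym (KP.zeroʳ _))))

  vec∘pad-linear : IsLinear (vec ∘ pad)
  vec∘pad-linear = linear-∘ vec-linear pad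
    (λ s t → trans (∷ʳ-⊞ (s ∷ʳ F.0#) (t ∷ʳ F.0#) F.0# F.0#)
               (cong₂ _∷ʳ_ (trans (∷ʳ-⊞ s t F.0# F.0#) (cong ((s ⊞ t) ∷ʳ_) 0+0≡0)) 0+0≡0))
    (λ r t → trans (∷ʳ-⊛ r (t ∷ʳ F.0#) F.0#)
               (cong₂ _∷ʳ_ (trans (∷ʳ-⊛ r t F.0#) (cong ((r ⊛ t) ∷ʳ_) (FP.zeroʳ r))) (FP.zeroʳ r)))
    where
    0+0≡0 : F.0# F.+ F.0# ≡ F.0#
    0+0≡0 = FP.+-identityʳ F.0#

  vec∘pad-injective : Injective _≡_ _≡_ (vec ∘ pad)
  vec∘pad-injective {xs} {ys} e =
    VecP.∷ʳ-injectiveˡ xs ys (VecP.∷ʳ-injectiveˡ (xs ∷ʳ F.0#) (ys ∷ʳ F.0#) (vec-injective (pad xs) (pad ys) e))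

  W∩head⇔image-pad : ∀ w → (W w × InSpan head w → Image (vec ∘ pad) w) × (Image (vec ∘ pad) w → W w × InSpan head w)
  W∩head⇔image-pad w = to , λ { (xs , refl) → (pad xs , refl) , (_ , vec-pad xs) }
    where
    to : W w × InSpan head w → Image (vec ∘ pad) w
    to ((t , refl) , c , vt≡c·head) with lastTwo t
    ... | split xs a b with eval-pair≡0 (begin
      eval (a ∷ b ∷ [])                   ≡⟨ cong proj₂ (sym (vec-split xs a b)) ⟩
      proj₂ (vec ((xs ∷ʳ a) ∷ʳ b))        ≡⟨ cong proj₂ vt≡c·head ⟩
      c K.* K.0#                          ≡⟨ KP.zeroʳ c ⟩
      K.0#                                ∎)
      where open ≡-Reasoning
    ...   | refl , refl = xs , refl

  weight-head : Weight W head m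
  weight-head = linear-image-hasDim vec∘pad-linear vec∘pad-injective W∩head⇔image-pad

  head∈C : InC head
  head∈C = (λ head≡0 → K.0≢1 (sym (cong proj₁ head≡0))) , pad e₀ , pad-e₀≢0ᵥ , vec-pad-e₀≢0 ,
           proj₂ (proj₂ (W∩head⇔image-pad (vec (pad e₀))) (e₀ , refl))
    where
    e₀ = F.1# ∷ 0ᵥ n
    pad-e₀≢0ᵥ : pad e₀ ≢ 0ᵥ h
    pad-e₀≢0ᵥ e = F.0≢1 (sym (cong Vec.head e))
    vec-pad-e₀≢0 : vec (pad e₀) ≢ zeroV
    vec-pad-e₀≢0 e = pad-e₀≢0ᵥ (vec-injective (pad e₀) (0ᵥ h) (trans e (sym vec-0ᵥ)))

  representative-scalar≢0 : ∀ v t c → vec t ≢ zeroV → vec t ≡ c · v → c ≢ K.0#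
  representative-scalar≢0 v t c vt≢0 vt≡c·v c≡0 = vt≢0 (trans vt≡c·v (trans (cong (_· v) c≡0) (0·v≡0 v)))

  representative-coord₂≢0 : ∀ v t c → vec t ≢ zeroV → vec t ≡ c · v → proj₂ v ≢ K.0# → coord₂ t ≢ K.0#
  representative-coord₂≢0 v t c vt≢0 vt≡c·v v₂≢0 e =
    KP.*-nonZero (representative-scalar≢0 v t c vt≢0 vt≡c·v) v₂≢0 (trans (sym (cong proj₂ vt≡c·v)) e)

  representative-⊛ : ∀ v t c r → vec t ≡ c · v → vec (r ⊛ t) ≡ (ι r K.* c) · v
  representative-⊛ v t c r vt≡c·v = trans (vec-⊛ r t) (trans (cong (ι r ·_) vt≡c·v) (·-assoc (ι r) c v))

  weight-off-head : ∀ v → InC v → ¬ SamePoint head v → Weight W v 1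
  weight-off-head v (v≢0 , t , _ , vt≢0 , c , vt≡c·v) v≁head =
    linear-image-hasDim (line-linear (vec t)) (line-injective (vec t) coord₂≢0) W∩v⇔line
    where
    v₂≢0 : proj₂ v ≢ K.0#
    v₂≢0 v₂≡0 = v≁head (proj₁ v , cong₂ _,_ (sym (KP.*-identityʳ _)) (trans v₂≡0 (sym (KP.zeroʳ _))))
    c≢0 = representative-scalar≢0 v t c vt≢0 vt≡c·v
    coord₂≢0 = representative-coord₂≢0 v t c vt≢0 vt≡c·v v₂≢0
    c⁻¹ = proj₁ (K.inverse c c≢0)
    rescale : ∀ c′ → c′ · v ≡ (c′ K.* c⁻¹) · vec t
    rescale c′ = begin
      c′ · v                  ≡⟨ cong (_· v) (sym c′c⁻¹c≡c′) ⟩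
      (c′ K.* c⁻¹ K.* c) · v  ≡⟨ sym (·-assoc _ c v) ⟩
      (c′ K.* c⁻¹) · (c · v)  ≡⟨ cong ((c′ K.* c⁻¹) ·_) (sym vt≡c·v) ⟩
      (c′ K.* c⁻¹) · vec t    ∎
      where
      open ≡-Reasoning
      c′c⁻¹c≡c′ : c′ K.* c⁻¹ K.* c ≡ c′
      c′c⁻¹c≡c′ = trans (solve 3 (λ x i c → x :* i :* c := x :* (c :* i)) refl c′ c⁻¹ c)
        (trans (cong (c′ K.*_) (proj₂ (K.inverse c c≢0))) (KP.*-identityʳ c′))
    W∩v⇔line : ∀ w → (W w × InSpan v w → Image (line (vec t)) w) × (Image (line (vec t)) w → W w × InSpan v w)
    W∩v⇔line w =
      (λ { ((s , refl) , c′ , vs≡c′·v) →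
           let (r , μ≡ιr) = vec-proportional⇒scalar∈F s t _ (trans vs≡c′·v (rescale c′)) coord₂≢0
           in r ∷ [] , sym (trans (trans vs≡c′·v (rescale c′)) (cong (_· vec t) μ≡ιr)) }) ,
      (λ { (r ∷ [] , refl) → (r ⊛ t , vec-⊛ r t) , ι r K.* c , trans (sym (vec-⊛ r t)) (representative-⊛ v t c r vt≡c·v) })

  Normal : Vec F.Carrier h → Set
  Normal t = ∃ λ xs → ∃₂ λ a b → t ≡ (xs ∷ʳ a) ∷ʳ b × FP.Normalised a b

  -- One representative of each point of 𝒞 other than the head: t_h = 1, or t_h = 0 and t_{h-1} = 1.
  rep₁ : Vec F.Carrier (suc m) → Vec F.Carrier h
  rep₁ u = u ∷ʳ F.1#

  rep₂ : Vec F.Carrier m → Vec F.Carrier h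
  rep₂ xs = (xs ∷ʳ F.1#) ∷ʳ F.0#

  reps₁ : List (Vec F.Carrier h)
  reps₁ = List.map rep₁ (vectors FinF.elements (suc m))

  reps₂ : List (Vec F.Carrier h)
  reps₂ = List.map rep₂ (vectors FinF.elements m)

  reps : List (Vec F.Carrier h)
  reps = reps₁ ++ reps₂

  length-reps : length reps ≡ q ^ suc m + q ^ m
  length-reps = trans (ListP.length-++ reps₁)
    (cong₂ _+_ (trans (ListP.length-map rep₁ (vectors FinF.elements (suc m))) (FinF.length-vectors-elements (suc m)))
               (trans (ListP.length-map rep₂ (vectors FinF.elements m)) (FinF.length-vectors-elements m)))

  reps-unique : Unique reps
  reps-unique = UniqueP.++⁺ {xs = reps₁} {ys = reps₂}
    (UniqueP.map⁺ {f = rep₁} (VecP.∷ʳ-injectiveˡ _ _) (vectors-unique FinF.elements-unique (suc m)))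
    (UniqueP.map⁺ {f = rep₂} (VecP.∷ʳ-injectiveˡ _ _ ∘ VecP.∷ʳ-injectiveˡ _ _) (vectors-unique FinF.elements-unique m))
    λ (∈reps₁ , ∈reps₂) → disjoint (∈P.∈-map⁻ rep₁ ∈reps₁) (∈P.∈-map⁻ rep₂ ∈reps₂)
    where
    disjoint : ∀ {t} → (∃ λ u → u ∈ vectors FinF.elements (suc m) × t ≡ rep₁ u) →
                       (∃ λ xs → xs ∈ vectors FinF.elements m × t ≡ rep₂ xs) → ⊥
    disjoint (u , _ , refl) (xs , _ , e) = F.0≢1 (sym (VecP.∷ʳ-injectiveʳ u _ e))

  reps-normal : All Normal reps
  reps-normal = AllP.++⁺ {xs = reps₁}
    (AllP.map⁺ {f = rep₁} (All.universal rep₁-normal (vectors FinF.elements (suc m))))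
    (AllP.map⁺ {f = rep₂} (All.universal (λ xs → xs , F.1# , F.0# , refl , inj₂ (refl , refl)) (vectors FinF.elements m)))
    where
    rep₁-normal : ∀ u → Normal (rep₁ u)
    rep₁-normal u with initLast u
    ... | xs , a , refl = xs , a , F.1# , refl , inj₁ refl

  normal⇒∈reps : ∀ {t} → Normal t → t ∈ reps
  normal⇒∈reps (xs , a , b , refl , inj₁ refl) =
    ∈P.∈-++⁺ˡ (∈P.∈-map⁺ rep₁ (∈-vectors FinF.∈-elements (xs ∷ʳ a)))
  normal⇒∈reps (xs , a , b , refl , inj₂ (refl , refl)) =
    ∈P.∈-++⁺ʳ reps₁ (∈P.∈-map⁺ rep₂ (∈-vectors FinF.∈-elements xs))

  normal⇒coord₂≢0 : ∀ {t} → Normal t → coord₂ t ≢ K.0#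
  normal⇒coord₂≢0 (xs , a , b , refl , ab-normal) e with eval-pair≡0 (trans (sym (coord₂-∷ʳ∷ʳ xs a b)) e)
  ... | a≡0 , b≡0 with FP.normalised≢0 ab-normal
  ...   | inj₁ a≢0 = a≢0 a≡0
  ...   | inj₂ b≢0 = b≢0 b≡0

  normal⇒∈C : ∀ {t} → Normal t → InC (vec t)
  normal⇒∈C {t} nt = vt≢0 , t , vec≢0⇒≢0ᵥ vt≢0 , vt≢0 , K.1# , sym (1·v≡v (vec t))
    where
    vt≢0 : vec t ≢ zeroV
    vt≢0 = normal⇒coord₂≢0 nt ∘ cong proj₂

  normal⇒≁head : ∀ {t} → Normal t → ¬ SamePoint (vec t) head
  normal⇒≁head {t} nt (c , head≡c·vt) = K.0≢1 (begin
    K.0#              ≡⟨ sym (KP.zeroˡ (coord₁ t)) ⟩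
    K.0# K.* coord₁ t ≡⟨ cong (K._* coord₁ t) (sym c≡0) ⟩
    c K.* coord₁ t    ≡⟨ sym (cong proj₁ head≡c·vt) ⟩
    K.1#              ∎)
    where
    open ≡-Reasoning
    c≡0 : c ≡ K.0#
    c≡0 = KP.x*y≡0⇒y≡0 (normal⇒coord₂≢0 nt) (trans (KP.*-comm (coord₂ t) c) (sym (cong proj₂ head≡c·vt)))

  normal-multiple⇒1 : ∀ {s t r} → Normal s → Normal t → t ≡ r ⊛ s → r ≡ F.1#
  normal-multiple⇒1 {r = r} (xs , a , b , refl , ab-normal) (ys , c , d , refl , cd-normal) t≡r⊛s =
    FP.normalised-unique ab-normal (subst₂ FP.Normalised
      (VecP.∷ʳ-injectiveʳ _ _ (VecP.∷ʳ-injectiveˡ _ _ last-two)) (VecP.∷ʳ-injectiveʳ _ _ last-two) cd-normal)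
    where
    last-two : (ys ∷ʳ c) ∷ʳ d ≡ ((r ⊛ xs) ∷ʳ (r F.* a)) ∷ʳ (r F.* b)
    last-two = trans t≡r⊛s (⊛-split r xs a b)

  normal-same-point⇒≡ : ∀ {s t} → Normal s → Normal t → SamePoint (vec s) (vec t) → s ≡ t
  normal-same-point⇒≡ {s} {t} ns nt (μ , vt≡μ·vs) = begin
    s          ≡⟨ sym (⊛-identityˡ s) ⟩
    F.1# ⊛ s   ≡⟨ cong (_⊛ s) (sym (normal-multiple⇒1 ns nt t≡r⊛s)) ⟩
    r ⊛ s      ≡⟨ sym t≡r⊛s ⟩
    t          ∎
    where
    open ≡-Reasoning
    μ∈F = vec-proportional⇒scalar∈F t s μ vt≡μ·vs (normal⇒coord₂≢0 ns)
    r = proj₁ μ∈F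
    t≡r⊛s : t ≡ r ⊛ s
    t≡r⊛s = vec-injective t (r ⊛ s) (trans vt≡μ·vs (trans (cong (_· vec s) (proj₂ μ∈F)) (sym (vec-⊛ r s))))

  points : List V
  points = List.map vec reps ++ head ∷ []

  points-distinct : AllPairs (λ u v → ¬ SamePoint u v) points
  points-distinct = AllPairsP.++⁺
    (allPairs-map vec (λ ns nt s≢t s∼t → s≢t (normal-same-point⇒≡ ns nt s∼t)) reps-normal reps-unique)
    ([] ∷ [])
    (AllP.map⁺ (All.map (λ nt → normal⇒≁head nt ∷ []) reps-normal))

  points-cover : ∀ v → InC v → Any (SamePoint v) points
  points-cover v (v≢0 , t , _ , vt≢0 , c , vt≡c·v) with proj₂ v FinK.≟ K.0#
  ... | yes v₂≡0 with K.inverse (proj₁ v) (λ v₁≡0 → v≢0 (cong₂ _,_ v₁≡0 v₂≡0))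
  ...   | v₁⁻¹ , v₁v₁⁻¹≡1 = AnyP.++⁺ʳ (List.map vec reps) (here (v₁⁻¹ , cong₂ _,_
          (sym (trans (KP.*-comm v₁⁻¹ (proj₁ v)) v₁v₁⁻¹≡1))
          (sym (trans (cong (v₁⁻¹ K.*_) v₂≡0) (KP.zeroʳ v₁⁻¹)))))
  points-cover v (v≢0 , t , _ , vt≢0 , c , vt≡c·v) | no v₂≢0 with lastTwo t
  ... | split xs a b with FP.normalise FinF._≟_ ab≢0
    where
    ab≢0 : ¬ (a ≡ F.0# × b ≡ F.0#)
    ab≢0 (refl , refl) = representative-coord₂≢0 v ((xs ∷ʳ F.0#) ∷ʳ F.0#) c vt≢0 vt≡c·v v₂≢0
      (trans (coord₂-∷ʳ∷ʳ xs F.0# F.0#) (eval-0ᵥ 2))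
  ...   | r , normalised = AnyP.++⁺ˡ (Any.map (λ { refl → ι r K.* c , representative-⊛ v ((xs ∷ʳ a) ∷ʳ b) c r vt≡c·v })
                                             (∈P.∈-map⁺ vec (normal⇒∈reps normal)))
    where
    normal : Normal (r ⊛ ((xs ∷ʳ a) ∷ʳ b))
    normal = r ⊛ xs , r F.* a , r F.* b , ⊛-split r xs a b , normalised

  number-of-points : NumPoints InC (q ^ suc (suc n) + q ^ suc n + 1)
  number-of-points = points , length-points , all-in-C , points-distinct , points-cover
    where
    length-points : length points ≡ q ^ suc (suc n) + q ^ suc n + 1
    length-points = trans (ListP.length-++ (List.map vec reps)) (cong (_+ 1) (trans (ListP.length-map vec reps) length-reps))
    all-in-C : All InC points
    all-in-C = AllP.++⁺ (AllP.map⁺ (All.map normal⇒∈C reps-normal)) (head∈C ∷ [])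

lemma2p12 : (q h : ℕ) →
  (∃ λ p → ∃ λ e → Prime p × 1 ≤ e × q ≡ p ^ e) →
  3 ≤ h →
  (F K : Field) → (Fin q ↔ Field.Carrier F) → (Fin (q ^ h) ↔ Field.Carrier K) →
  (E : Embedding F K) →
  (lam : Field.Carrier K) → Field.Primitive K lam →
  let open LinearSets F K E
      open ClubExample F K E h lam
      head = (Field.1# K , Field.0# K)
  in
  HasDim W h ×
  (∀ v → (InC v → InLinSet W v) × (InLinSet W v → InC v)) ×
  InC head ×
  Weight W head (h ∸ 2) ×
  (∀ v → InC v → ¬ SamePoint head v → Weight W v 1) ×
  NumPoints InC (q ^ (h ∸ 1) + q ^ (h ∸ 2) + 1)
lemma2p12 q _ _ (s≤s (s≤s (s≤s (z≤n {n})))) F K enumF enumK E lam prim =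
  dim-W , InC⇔InLinSet , head∈C , weight-head , weight-off-head , number-of-points
  where open Club E n prim enumF enumK
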